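{- Let $c$, $k$ and $t$ be positive integers with $c\ge 2$ and $k\ge t+2$. Suppose $(\mathcal{F},\mathcal{G})$ is a maximal pair of cross $t$-intersecting subfamilies of $U^{[ck]}_{c,k}$ with $\max\{\tau_t(\mathcal{F}),\tau_t(\mathcal{G})\}\le k-2$. Then $\mathcal{T}_t(\mathcal{F})$ and $\mathcal{T}_t(\mathcal{G})$ are cross $t$-intersecting.
   Context: $U^{[ck]}_{c,\ell}$ is the set of families of $\ell$ pairwise disjoint $c$-subsets ("blocks") of $[ck]$; members are sets of blocks, $A\cap B$ is the set of common blocks. Families $\mathcal{A}\subseteq U^{[ck]}_{c,\ell}$, $\mathcal{B}\subseteq U^{[ck]}_{c,m}$ are cross $t$-intersecting if $|A\cap B|\ge t$ for all $A\in\mathcal{A}$, $B\in\mathcal{B}$. A cross $t$-intersecting pair $(\mathcal{F},\mathcal{G})$ of subfamilies of $U^{[ck]}_{c,k}$ is maximal if there is no cross $t$-intersecting pair $(\mathcal{F}',\mathcal{G}')\ne(\mathcal{F},\mathcal{G})$ of subfamilies of $U^{[ck]}_{c,k}$ with $\mathcal{F}\subseteq\mathcal{F}'$, $\mathcal{G}\subseteq\mathcal{G}'$. For $\mathcal{A}\subseteq U^{[ck]}_{c,\ell}$, $S\in U^{[ck]}_{c,s}$ is a $t$-cover of $\mathcal{A}$ if $|S\cap A|\ge t$ for all $A\in\mathcal{A}$; $\tau_t(\mathcal{A})$ is the minimum size $s$ of a $t$-cover, and $\mathcal{T}_t(\mathcal{A})$ is the set of all $t$-covers of $\mathcal{A}$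 in $U^{[ck]}_{c,\tau_t(\mathcal{A})}$. -}

module Defs where

open import Data.Nat using (ℕ; _*_; _≥_; _≤_; _<_)
open import Data.Bool.Properties using () renaming (_≟_ to _≟B_)
open import Data.Fin.Subset using (Subset; ∣_∣; _∩_; ⊥)
open import Data.Vec.Properties using (≡-dec)
open import Data.List using (List; length; filter)
open import Data.List.Relation.Unary.All using (All)
open import Data.List.Relation.Unary.AllPairs using (AllPairs)
import Data.List.Membership.DecPropositional as DecMem
open import Data.Product using (Σ; _×_)
open import Relation.Binary.PropositionalEquality using (_≡_)
open import Relation.Nullary using (¬_)

-- Ground set [n] is Fin n; a block is a c-subset of [n] (here n = c k).
-- A member of U^{[n]}_{c,ℓ}: a list of ℓ pairwise disjoint c-subsets.
-- (Pairwise disjoint nonempty blocks are automatically distinct, so the list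
-- is a duplicate-free enumeration of the set of blocks; the order is irrelevant
-- for everything below.)
record Member (n c ℓ : ℕ) : Set where
  constructor member
  field
    blocks   : List (Subset n)
    len      : length blocks ≡ ℓ
    size     : All (λ b → ∣ b ∣ ≡ c) blocks
    disjoint : AllPairs (λ a b → a ∩ b ≡ ⊥) blocks

open Member public

common : ∀ {n c ℓ m} → Member n c ℓ → Member n c m → ℕ
common {n} A B = length (filter (λ b → b ∈? blocks B) (blocks A))
  where open DecMem (≡-dec {n = n} _≟B_) using (_∈?_)

Family : ℕ → ℕ → ℕ → Set₁
Family n c ℓ = Member n c ℓ → Set

_⊆F_ : ∀ {n c ℓ} → Family n c ℓ → Family n c ℓ → Set
F ⊆F F′ = ∀ A → F A → F′ A

CrossInt : ∀ {n c ℓ m} → ℕ → Family n c ℓ → Family n c m → Set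
CrossInt t F G = ∀ A B → F A → G B → common A B ≥ t

MaximalCrossInt : (c k t : ℕ) → Family (c * k) c k → Family (c * k) c k → Set₁
MaximalCrossInt c k t F G =
  CrossInt t F G ×
  (∀ (F′ G′ : Family (c * k) c k) → F ⊆F F′ → G ⊆F G′ → CrossInt t F′ G′ →
     (F′ ⊆F F) × (G′ ⊆F G))

IsCover : ∀ {n c ℓ s} → ℕ → Family n c ℓ → Member n c s → Set
IsCover t 𝒜 S = ∀ A → 𝒜 A → common S A ≥ t

IsTau : ∀ {n ℓ} (c t : ℕ) → Family n c ℓ → ℕ → Set
IsTau {n} c t 𝒜 s =
  Σ (Member n c s) (IsCover t 𝒜) ×
  (∀ s′ → s′ < s → (S : Member n c s′) → ¬ IsCover t 𝒜 S)

-- Let S, S′ be t-covers of F, G of sizes at most k − 2.  Complete S′ to a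
-- member A by blocks that are not blocks of S, and then S to a member B by
-- blocks that are not blocks of A; with at least two blocks to add and c ≥ 2
-- this is always possible.  A contains S′, so A meets every member of G in at
-- least t blocks and maximality puts A into F; symmetrically B ∈ G.  Hence
-- t ≤ |A ∩ B|, and by construction every common block of A and B is a common
-- block of S′ and S.
module Submission where

open import Defs
open import Data.Bool.Properties using () renaming (_≟_ to _≟B_)
open import Data.Empty using (⊥-elim)
open import Data.Fin.Subset
  using (Subset; ∣_∣; _∈_; _∉_; _⊆_; _∩_; _∪_; ∁; ⋃; ⊥; inside; outside; Nonempty)
open import Data.Fin.Subset.Properties
  using ( ∉⊥; ⊥⊆; ∣⊥∣≡0; Empty-unique; nonempty?; x∈p∩q⁺; x∈p∩q⁻; x∈p∪q⁻
        ; p⊆p∪q; q⊆p∪q; ⊆-refl; ⊆-trans; ∩-comm; ∩-zeroˡ; ∩-zeroʳ; ∩-inverseʳ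
        ; ∩-distribˡ-∪; ∩-distribʳ-∪; ∪-identityˡ; ∣∁p∣≡n∸∣p∣ )
open import Data.List using (List; []; _∷_; length; filter; _++_)
open import Data.List.Properties using (length-++; filter-++; filter-none; filter-notAll)
open import Data.List.Membership.Propositional using () renaming (_∈_ to _∈ₗ_; _∉_ to _∉ₗ_)
open import Data.List.Membership.Propositional.Properties using (∈-filter⁺; ∈-filter⁻; ∈-++⁺ˡ; ∈-++⁺ʳ; ∈-++⁻)
import Data.List.Membership.DecPropositional as DecMembership
open import Data.List.Relation.Unary.All using (All; []; _∷_)
import Data.List.Relation.Unary.All as All
open import Data.List.Relation.Unary.All.Properties using (++⁺)
open import Data.List.Relation.Unary.Any using (here; there)
import Data.List.Relation.Unary.Any as Any
open import Data.List.Relation.Unary.AllPairs using (AllPairs; []; _∷_)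
import Data.List.Relation.Unary.AllPairs.Properties as AllPairs
open import Data.List.Relation.Unary.Unique.Propositional using (Unique)
open import Data.List.Relation.Unary.Unique.Propositional.Properties using (filter⁺)
open import Data.Nat using (ℕ; zero; suc; _+_; _*_; _∸_; _≤_; _≥_; z≤n; s≤s)
open import Data.Nat.Properties
  using ( +-suc; +-assoc; +-identityʳ; *-comm; *-distribʳ-+; m+n∸m≡n; suc-injective
        ; m≤m+n; m≤n+m; m≤n⇒m≤1+n; ≤-trans; m≤n⇒∃[o]m+o≡n; m≤o∸n⇒m+n≤o; module ≤-Reasoning )
open import Data.Product using (Σ-syntax; _×_; _,_; proj₁; proj₂)
open import Data.Sum using (_⊎_; inj₁; inj₂; [_,_]′)
open import Data.Vec using (_∷_; []; here; there)
open import Data.Vec.Properties using (≡-dec; ∷-injectiveʳ)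
open import Function using (_∘_; id)
open import Relation.Binary.Definitions using (DecidableEquality)
open import Relation.Binary.PropositionalEquality using (_≡_; refl; sym; trans; cong; cong₂; subst; module ≡-Reasoning)
open import Relation.Nullary using (¬_; Dec; yes; no; ¬?)
open import Relation.Unary using (Pred; Decidable)

length-filter-≤ : ∀ {A : Set} {p q} {P : Pred A p} {Q : Pred A q} (P? : Decidable P) (Q? : Decidable Q)
  {xs : List A} → All (λ x → P x → Q x) xs → length (filter P? xs) ≤ length (filter Q? xs)
length-filter-≤ P? Q? {[]} [] = z≤n
length-filter-≤ P? Q? {x ∷ xs} (P⇒Q ∷ rest) with P? x | Q? x
... | yes _  | yes _  = s≤s (length-filter-≤ P? Q? rest)
... | yes px | no ¬qx = ⊥-elim (¬qx (P⇒Q px))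
... | no _   | yes _  = m≤n⇒m≤1+n (length-filter-≤ P? Q? rest)
... | no _   | no _   = length-filter-≤ P? Q? rest

module Count {A : Set} (_≟_ : DecidableEquality A) where
  open DecMembership _≟_ using (_∈?_)
  open ≤-Reasoning

  count : List A → List A → ℕ
  count xs ys = length (filter (_∈? ys) xs)

  Unique⇒length≤ : ∀ {xs ys : List A} → Unique xs → (∀ {x} → x ∈ₗ xs → x ∈ₗ ys) → length xs ≤ length ys
  Unique⇒length≤ {[]} _ _ = z≤n
  Unique⇒length≤ {x ∷ xs} {ys} (x∉xs ∷ unique) xs⊆ys = begin
    suc (length xs)              ≤⟨ s≤s (Unique⇒length≤ unique xs⊆ys-x) ⟩
    suc (length (filter ≢x? ys)) ≤⟨ filter-notAll ≢x? ys (Any.map (λ x≡y x≢y → x≢y x≡y) (xs⊆ys (here refl))) ⟩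
    length ys                    ∎
    where
    ≢x? : Decidable (λ y → ¬ x ≡ y)
    ≢x? y = ¬? (x ≟ y)
    xs⊆ys-x : ∀ {y} → y ∈ₗ xs → y ∈ₗ filter ≢x? ys
    xs⊆ys-x y∈xs = ∈-filter⁺ ≢x? (xs⊆ys (there y∈xs)) (All.lookup x∉xs y∈xs)

  count-comm-≤ : ∀ {xs ys} → Unique xs → count xs ys ≤ count ys xs
  count-comm-≤ {xs} {ys} unique = Unique⇒length≤ (filter⁺ (_∈? ys) unique) swap
    where
    swap : ∀ {z} → z ∈ₗ filter (_∈? ys) xs → z ∈ₗ filter (_∈? xs) ys
    swap z∈ = let z∈xs , z∈ys = ∈-filter⁻ (_∈? ys) z∈ in ∈-filter⁺ (_∈? xs) z∈ys z∈xs

  count-mono : ∀ {xs ys ys′} → All (λ x → x ∈ₗ ys → x ∈ₗ ys′) xs → count xs ys ≤ count xs ys′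
  count-mono {ys = ys} {ys′} = length-filter-≤ (_∈? ys) (_∈? ys′)

  count-++ : ∀ xs zs {ys} → count (xs ++ zs) ys ≡ count xs ys + count zs ys
  count-++ xs zs {ys} = trans (cong length (filter-++ (_∈? ys) xs zs)) (length-++ (filter (_∈? ys) xs))

  count≤count-++ˡ : ∀ xs zs {ys} → count xs ys ≤ count (xs ++ zs) ys
  count≤count-++ˡ xs zs {ys} = begin
    count xs ys                 ≤⟨ m≤m+n (count xs ys) (count zs ys) ⟩
    count xs ys + count zs ys   ≡⟨ count-++ xs zs ⟨
    count (xs ++ zs) ys         ∎

  count≤count-++ʳ : ∀ xs ys zs → count xs ys ≤ count xs (ys ++ zs)
  count≤count-++ʳ xs ys zs = count-mono {xs = xs} (All.tabulate λ _ → ∈-++⁺ˡ)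

  count-++-∉ : ∀ xs {zs ys} → All (_∉ₗ ys) zs → count (xs ++ zs) ys ≡ count xs ys
  count-++-∉ xs {zs} {ys} zs∉ys = begin-equality
    count (xs ++ zs) ys         ≡⟨ count-++ xs zs ⟩
    count xs ys + count zs ys   ≡⟨ cong (λ l → count xs ys + length l) (filter-none (_∈? ys) zs∉ys) ⟩
    count xs ys + 0             ≡⟨ +-identityʳ (count xs ys) ⟩
    count xs ys                 ∎

  count-++-fresh-≤ : ∀ {xs xs′ ys ys′} → Unique ys → All (_∉ₗ xs) ys′ → All (_∉ₗ ys ++ ys′) xs′ →
    count (ys ++ ys′) (xs ++ xs′) ≤ count xs ys
  count-++-fresh-≤ {xs} {xs′} {ys} {ys′} unique ys′∉xs xs′∉ys++ys′ = begin
    count (ys ++ ys′) (xs ++ xs′)   ≡⟨ count-++-∉ ys (All.tabulate ys′∉xs++xs′) ⟩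
    count ys (xs ++ xs′)            ≤⟨ count-mono (All.tabulate ys∩[xs++xs′]⊆xs) ⟩
    count ys xs                     ≤⟨ count-comm-≤ unique ⟩
    count xs ys                     ∎
    where
    ys′∉xs++xs′ : ∀ {y} → y ∈ₗ ys′ → y ∉ₗ xs ++ xs′
    ys′∉xs++xs′ y∈ys′ y∈xs++xs′ =
      [ All.lookup ys′∉xs y∈ys′ , (λ y∈xs′ → All.lookup xs′∉ys++ys′ y∈xs′ (∈-++⁺ʳ ys y∈ys′)) ]′ (∈-++⁻ xs y∈xs++xs′)
    ys∩[xs++xs′]⊆xs : ∀ {y} → y ∈ₗ ys → y ∈ₗ xs ++ xs′ → y ∈ₗ xs
    ys∩[xs++xs′]⊆xs y∈ys y∈xs++xs′ =
      [ id , (λ y∈xs′ → ⊥-elim (All.lookup xs′∉ys++ys′ y∈xs′ (∈-++⁺ˡ y∈ys))) ]′ (∈-++⁻ xs y∈xs++xs′)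

private
  variable
    n : ℕ

Disjoint : Subset n → Subset n → Set
Disjoint p q = p ∩ q ≡ ⊥

Disjoint-sym : ∀ {p q : Subset n} → Disjoint p q → Disjoint q p
Disjoint-sym {p = p} {q} p∩q≡⊥ = trans (∩-comm q p) p∩q≡⊥

Disjoint⇒¬Nonempty : ∀ {p q : Subset n} → Disjoint p q → ¬ Nonempty (p ∩ q)
Disjoint⇒¬Nonempty p∩q≡⊥ (x , x∈p∩q) = ∉⊥ (subst (x ∈_) p∩q≡⊥ x∈p∩q)

Disjoint⇒∉ : ∀ {p q : Subset n} {x} → Disjoint p q → x ∈ p → x ∉ q
Disjoint⇒∉ p∩q≡⊥ x∈p x∈q = Disjoint⇒¬Nonempty p∩q≡⊥ (_ , x∈p∩q⁺ (x∈p , x∈q))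

∉⇒Disjoint : ∀ {p q : Subset n} → (∀ {x} → x ∈ p → x ∉ q) → Disjoint p q
∉⇒Disjoint {p = p} {q} p∉q = Empty-unique λ (x , x∈p∩q) → let x∈p , x∈q = x∈p∩q⁻ p q x∈p∩q in p∉q x∈p x∈q

⊆-Disjoint : ∀ {p p′ q q′ : Subset n} → p′ ⊆ p → q′ ⊆ q → Disjoint p q → Disjoint p′ q′
⊆-Disjoint p′⊆p q′⊆q p∩q≡⊥ = ∉⇒Disjoint λ x∈p′ x∈q′ → Disjoint⇒∉ p∩q≡⊥ (p′⊆p x∈p′) (q′⊆q x∈q′)

∪-Disjointˡ : ∀ {p q r : Subset n} → Disjoint p r → Disjoint q r → Disjoint (p ∪ q) r
∪-Disjointˡ {p = p} {q} {r} p∩r≡⊥ q∩r≡⊥ =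
  trans (∩-distribʳ-∪ r p q) (trans (cong₂ _∪_ p∩r≡⊥ q∩r≡⊥) (∪-identityˡ ⊥))

∪-Disjointʳ : ∀ {p q r : Subset n} → Disjoint p q → Disjoint p r → Disjoint p (q ∪ r)
∪-Disjointʳ {p = p} {q} {r} p∩q≡⊥ p∩r≡⊥ =
  trans (∩-distribˡ-∪ p q r) (trans (cong₂ _∪_ p∩q≡⊥ p∩r≡⊥) (∪-identityˡ ⊥))

∪-⊆ : ∀ {p q r : Subset n} → p ⊆ r → q ⊆ r → p ∪ q ⊆ r
∪-⊆ {p = p} {q} p⊆r q⊆r x∈p∪q = [ p⊆r , q⊆r ]′ (x∈p∪q⁻ p q x∈p∪q)

⊆-Nonempty-∩ : ∀ {p q r : Subset n} → Nonempty p → p ⊆ q → p ⊆ r → Nonempty (q ∩ r)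
⊆-Nonempty-∩ (x , x∈p) p⊆q p⊆r = x , x∈p∩q⁺ (p⊆q x∈p , p⊆r x∈p)

∣p∣≡1+m⇒Nonempty : ∀ {n} {p : Subset n} {m} → ∣ p ∣ ≡ suc m → Nonempty p
∣p∣≡1+m⇒Nonempty {n} {p} ∣p∣≡1+m with nonempty? p
... | yes nonempty = nonempty
... | no empty with () ← trans (sym ∣p∣≡1+m) (trans (cong ∣_∣ (Empty-unique empty)) (∣⊥∣≡0 n))

∣p∪q∣≡∣p∣+∣q∣ : ∀ {p q : Subset n} → Disjoint p q → ∣ p ∪ q ∣ ≡ ∣ p ∣ + ∣ q ∣
∣p∪q∣≡∣p∣+∣q∣ {p = []}          {[]}          _ = refl
∣p∪q∣≡∣p∣+∣q∣ {p = inside ∷ p}  {inside ∷ q}  ()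
∣p∪q∣≡∣p∣+∣q∣ {p = inside ∷ p}  {outside ∷ q} disjoint = cong suc (∣p∪q∣≡∣p∣+∣q∣ (∷-injectiveʳ disjoint))
∣p∪q∣≡∣p∣+∣q∣ {p = outside ∷ p} {inside ∷ q}  disjoint =
  trans (cong suc (∣p∪q∣≡∣p∣+∣q∣ (∷-injectiveʳ disjoint))) (sym (+-suc ∣ p ∣ ∣ q ∣))
∣p∪q∣≡∣p∣+∣q∣ {p = outside ∷ p} {outside ∷ q} disjoint = ∣p∪q∣≡∣p∣+∣q∣ (∷-injectiveʳ disjoint)

prefix : ℕ → Subset n → Subset n
prefix zero    p             = ⊥
prefix (suc i) []            = []
prefix (suc i) (inside ∷ p)  = inside ∷ prefix i p
prefix (suc i) (outside ∷ p) = outside ∷ prefix (suc i) p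

suffix : ℕ → Subset n → Subset n
suffix zero    p             = p
suffix (suc i) []            = []
suffix (suc i) (inside ∷ p)  = outside ∷ suffix i p
suffix (suc i) (outside ∷ p) = outside ∷ suffix (suc i) p

prefix⊆ : ∀ i (p : Subset n) → prefix i p ⊆ p
prefix⊆ zero    p             = ⊥⊆
prefix⊆ (suc i) (inside ∷ p)  here          = here
prefix⊆ (suc i) (inside ∷ p)  (there x∈)    = there (prefix⊆ i p x∈)
prefix⊆ (suc i) (outside ∷ p) (there x∈)    = there (prefix⊆ (suc i) p x∈)

suffix⊆ : ∀ i (p : Subset n) → suffix i p ⊆ p
suffix⊆ zero    p             x∈         = x∈
suffix⊆ (suc i) (inside ∷ p)  (there x∈) = there (suffix⊆ i p x∈)
suffix⊆ (suc i) (outside ∷ p) (there x∈) = there (suffix⊆ (suc i) p x∈)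

prefix-suffix-Disjoint : ∀ i (p : Subset n) → Disjoint (prefix i p) (suffix i p)
prefix-suffix-Disjoint zero    p             = ∩-zeroˡ p
prefix-suffix-Disjoint (suc i) []            = refl
prefix-suffix-Disjoint (suc i) (inside ∷ p)  = cong (outside ∷_) (prefix-suffix-Disjoint i p)
prefix-suffix-Disjoint (suc i) (outside ∷ p) = cong (outside ∷_) (prefix-suffix-Disjoint (suc i) p)

∣prefix∣≡ : ∀ i {j} (p : Subset n) → ∣ p ∣ ≡ i + j → ∣ prefix i p ∣ ≡ i
∣prefix∣≡ {n} zero p            _    = ∣⊥∣≡0 n
∣prefix∣≡ (suc i) []            ()
∣prefix∣≡ (suc i) (inside ∷ p)  ∣p∣≡ = cong suc (∣prefix∣≡ i p (suc-injective ∣p∣≡))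
∣prefix∣≡ (suc i) (outside ∷ p) ∣p∣≡ = ∣prefix∣≡ (suc i) p ∣p∣≡

∣suffix∣≡ : ∀ i {j} (p : Subset n) → ∣ p ∣ ≡ i + j → ∣ suffix i p ∣ ≡ j
∣suffix∣≡ zero    p             ∣p∣≡ = ∣p∣≡
∣suffix∣≡ (suc i) []            ()
∣suffix∣≡ (suc i) (inside ∷ p)  ∣p∣≡ = ∣suffix∣≡ i p (suc-injective ∣p∣≡)
∣suffix∣≡ (suc i) (outside ∷ p) ∣p∣≡ = ∣suffix∣≡ (suc i) p ∣p∣≡

record Split (R : Subset n) (i j : ℕ) : Set where
  field
    left right   : Subset n
    ∣left∣≡      : ∣ left ∣ ≡ i
    ∣right∣≡     : ∣ right ∣ ≡ j
    left⊆        : left ⊆ R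
    right⊆       : right ⊆ R
    left∩right≡⊥ : Disjoint left right

open Split

splitAt : ∀ i {j} {R : Subset n} → ∣ R ∣ ≡ i + j → Split R i j
splitAt i {R = R} ∣R∣≡ = record
  { left  = prefix i R ; ∣left∣≡  = ∣prefix∣≡ i R ∣R∣≡ ; left⊆  = prefix⊆ i R
  ; right = suffix i R ; ∣right∣≡ = ∣suffix∣≡ i R ∣R∣≡ ; right⊆ = suffix⊆ i R
  ; left∩right≡⊥ = prefix-suffix-Disjoint i R
  }

castʳ : ∀ {R : Subset n} {i j j′} → j ≡ j′ → Split R i j → Split R i j′
castʳ j≡j′ s = record
  { left  = left s  ; ∣left∣≡  = ∣left∣≡ s                 ; left⊆  = left⊆ s
  ; right = right s ; ∣right∣≡ = trans (∣right∣≡ s) j≡j′ ; right⊆ = right⊆ s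
  ; left∩right≡⊥ = left∩right≡⊥ s
  }

Straddles : ∀ {R : Subset n} {i j} → Subset n → Split R i j → Set
Straddles q s = Nonempty (q ∩ left s) × Nonempty (q ∩ right s)

crossover : ∀ {R : Subset n} {i₁ i₂ j₁ j₂} (s : Split R (suc i₁ + suc i₂) (suc j₁ + suc j₂)) →
  Σ[ s′ ∈ Split R (suc i₁ + suc j₁) (suc i₂ + suc j₂) ] Straddles (left s′) s × Straddles (right s′) s
crossover {i₁ = i₁} {j₁ = j₁} s =
  s′ , (meets (∣left∣≡ l) (p⊆p∪q _) (left⊆ l) , meets (∣left∣≡ r) (q⊆p∪q _ _) (left⊆ r))
     , (meets (∣right∣≡ l) (p⊆p∪q _) (right⊆ l) , meets (∣right∣≡ r) (q⊆p∪q _ _) (right⊆ r))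
  where
  l = splitAt (suc i₁) (∣left∣≡ s)
  r = splitAt (suc j₁) (∣right∣≡ s)
  l⊥r : ∀ {p q} → p ⊆ left s → q ⊆ right s → Disjoint p q
  l⊥r p⊆ q⊆ = ⊆-Disjoint p⊆ q⊆ (left∩right≡⊥ s)
  s′ : Split _ _ _
  s′ = record
    { left     = left l ∪ left r
    ; right    = right l ∪ right r
    ; ∣left∣≡  = trans (∣p∪q∣≡∣p∣+∣q∣ (l⊥r (left⊆ l) (left⊆ r))) (cong₂ _+_ (∣left∣≡ l) (∣left∣≡ r))
    ; ∣right∣≡ = trans (∣p∪q∣≡∣p∣+∣q∣ (l⊥r (right⊆ l) (right⊆ r))) (cong₂ _+_ (∣right∣≡ l) (∣right∣≡ r))
    ; left⊆    = ∪-⊆ (⊆-trans (left⊆ l) (left⊆ s)) (⊆-trans (left⊆ r) (right⊆ s))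
    ; right⊆   = ∪-⊆ (⊆-trans (right⊆ l) (left⊆ s)) (⊆-trans (right⊆ r) (right⊆ s))
    ; left∩right≡⊥ =
        ∪-Disjointˡ (∪-Disjointʳ (left∩right≡⊥ l) (l⊥r (left⊆ l) (right⊆ r)))
                    (∪-Disjointʳ (Disjoint-sym (l⊥r (right⊆ l) (left⊆ r))) (left∩right≡⊥ r))
    }
  meets : ∀ {p q t : Subset _} {m} → ∣ p ∣ ≡ suc m → p ⊆ q → p ⊆ t → Nonempty (q ∩ t)
  meets = ⊆-Nonempty-∩ ∘ ∣p∣≡1+m⇒Nonempty

_∈ₗ?_ : (p : Subset n) (D : List (Subset n)) → Dec (p ∈ₗ D)
_∈ₗ?_ = DecMembership._∈?_ (≡-dec _≟B_)

Nonempty-∩-comm : ∀ {p q : Subset n} → Nonempty (p ∩ q) → Nonempty (q ∩ p)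
Nonempty-∩-comm {p = p} {q} = subst Nonempty (∩-comm p q)

meeting-members-≡ : ∀ {D : List (Subset n)} {p q} → AllPairs Disjoint D →
  p ∈ₗ D → q ∈ₗ D → Nonempty (p ∩ q) → p ≡ q
meeting-members-≡ (_ ∷ _)          (here refl) (here refl) _    = refl
meeting-members-≡ (p⊥rest ∷ _)     (here refl) (there q∈D) meet = ⊥-elim (Disjoint⇒¬Nonempty (All.lookup p⊥rest q∈D) meet)
meeting-members-≡ (q⊥rest ∷ _)     (there p∈D) (here refl) meet =
  ⊥-elim (Disjoint⇒¬Nonempty (All.lookup q⊥rest p∈D) (Nonempty-∩-comm meet))
meeting-members-≡ (_ ∷ pairwise)   (there p∈D) (there q∈D) meet = meeting-members-≡ pairwise p∈D q∈D meet

straddler∉ : ∀ {D : List (Subset n)} {p q r} → AllPairs Disjoint D → Disjoint p r →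
  Nonempty (q ∩ p) → Nonempty (q ∩ r) → p ∈ₗ D ⊎ r ∈ₗ D → q ∉ₗ D
straddler∉ pairwise p⊥r q∩p q∩r (inj₁ p∈D) q∈D with meeting-members-≡ pairwise q∈D p∈D q∩p
... | refl = Disjoint⇒¬Nonempty p⊥r q∩r
straddler∉ pairwise p⊥r q∩p q∩r (inj₂ r∈D) q∈D with meeting-members-≡ pairwise q∈D r∈D q∩r
... | refl = Disjoint⇒¬Nonempty (Disjoint-sym p⊥r) q∩p

AvoidingSplit : List (Subset n) → Subset n → ℕ → ℕ → Set
AvoidingSplit D R i j = Σ[ s ∈ Split R i j ] left s ∉ₗ D × right s ∉ₗ D

-- If one part of the obvious split is a member of D, the crossed split cannot
-- contain a member of D: its parts meet two disjoint sets, one of them in D.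
avoidingSplit : ∀ {D : List (Subset n)} {R c j} → AllPairs Disjoint D →
  ∣ R ∣ ≡ suc (suc c) + (suc (suc c) + j) → AvoidingSplit D R (suc (suc c)) (suc (suc c) + j)
avoidingSplit {D = D} {c = c} {j} pairwise ∣R∣≡ = choose (left s ∈ₗ? D) (right s ∈ₗ? D)
  where
  s = splitAt (suc (suc c)) ∣R∣≡
  s♯ : Split _ (suc zero + suc c) (suc c + suc j)
  s♯ = castʳ (cong suc (sym (+-suc c j))) s
  crossed : left s ∈ₗ D ⊎ right s ∈ₗ D → AvoidingSplit D _ (suc (suc c)) (suc (suc c) + j)
  crossed part∈D with crossover {i₁ = zero} {j₁ = c} s♯
  ... | s′ , (left∩l , left∩r) , (right∩l , right∩r) =
    castʳ (cong suc (+-suc c j)) s′ ,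
    straddler∉ pairwise (left∩right≡⊥ s) left∩l left∩r part∈D ,
    straddler∉ pairwise (left∩right≡⊥ s) right∩l right∩r part∈D
  choose : Dec (left s ∈ₗ D) → Dec (right s ∈ₗ D) → AvoidingSplit D _ (suc (suc c)) (suc (suc c) + j)
  choose (yes left∈D) _             = crossed (inj₁ left∈D)
  choose (no _)       (yes right∈D) = crossed (inj₂ right∈D)
  choose (no left∉D)  (no right∉D)  = s , left∉D , right∉D

record Packing (D : List (Subset n)) (R : Subset n) (c m : ℕ) : Set where
  field
    pieces          : List (Subset n)
    pieces-length   : length pieces ≡ m
    pieces-size     : All (λ b → ∣ b ∣ ≡ c) pieces
    pieces-disjoint : AllPairs Disjoint pieces
    pieces⊆         : All (_⊆ R) pieces
    pieces∉D        : All (_∉ₗ D) pieces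

open Packing

avoidingPacking : ∀ {D : List (Subset n)} {c} → AllPairs Disjoint D →
  ∀ m {R} → ∣ R ∣ ≡ suc (suc m) * suc (suc c) → Packing D R (suc (suc c)) (suc (suc m))
avoidingPacking pairwise zero ∣R∣≡ with avoidingSplit pairwise ∣R∣≡
... | s , left∉D , right∉D = record
  { pieces          = left s ∷ right s ∷ []
  ; pieces-length   = refl
  ; pieces-size     = ∣left∣≡ s ∷ trans (∣right∣≡ s) (+-identityʳ _) ∷ []
  ; pieces-disjoint = (left∩right≡⊥ s ∷ []) ∷ [] ∷ []
  ; pieces⊆         = left⊆ s ∷ right⊆ s ∷ []
  ; pieces∉D        = left∉D ∷ right∉D ∷ []
  }
avoidingPacking pairwise (suc m) ∣R∣≡ with avoidingSplit pairwise ∣R∣≡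
... | s , left∉D , _ = record
  { pieces          = left s ∷ pieces rest
  ; pieces-length   = cong suc (pieces-length rest)
  ; pieces-size     = ∣left∣≡ s ∷ pieces-size rest
  ; pieces-disjoint = All.map left⊥ (pieces⊆ rest) ∷ pieces-disjoint rest
  ; pieces⊆         = left⊆ s ∷ All.map ⊆R (pieces⊆ rest)
  ; pieces∉D        = left∉D ∷ pieces∉D rest
  }
  where
  rest = avoidingPacking pairwise m (∣right∣≡ s)
  left⊥ : ∀ {b} → b ⊆ right s → Disjoint (left s) b
  left⊥ b⊆ = ⊆-Disjoint ⊆-refl b⊆ (left∩right≡⊥ s)
  ⊆R : ∀ {b} → b ⊆ right s → b ⊆ _
  ⊆R b⊆ = ⊆-trans b⊆ (right⊆ s)

⊆⋃ : ∀ {p : Subset n} {ps} → p ∈ₗ ps → p ⊆ ⋃ ps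
⊆⋃ {ps = _ ∷ ps} (here refl)  = p⊆p∪q (⋃ ps)
⊆⋃ {ps = q ∷ ps} (there p∈ps) = ⊆-trans (⊆⋃ p∈ps) (q⊆p∪q q (⋃ ps))

Disjoint-⋃ : ∀ {p : Subset n} {ps} → All (Disjoint p) ps → Disjoint p (⋃ ps)
Disjoint-⋃ {p = p} []           = ∩-zeroʳ p
Disjoint-⋃         (p⊥q ∷ p⊥ps) = ∪-Disjointʳ p⊥q (Disjoint-⋃ p⊥ps)

∣⋃∣≡ : ∀ {c} {ps : List (Subset n)} → All (λ b → ∣ b ∣ ≡ c) ps → AllPairs Disjoint ps →
  ∣ ⋃ ps ∣ ≡ length ps * c
∣⋃∣≡ {n} []               []                = ∣⊥∣≡0 n
∣⋃∣≡     (∣p∣≡c ∷ ∣ps∣≡c) (p⊥ps ∷ pairwise) =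
  trans (∣p∪q∣≡∣p∣+∣q∣ (Disjoint-⋃ p⊥ps)) (cong₂ _+_ ∣p∣≡c (∣⋃∣≡ ∣ps∣≡c pairwise))

Disjoint⇒Unique : ∀ {ps : List (Subset n)} → All Nonempty ps → AllPairs Disjoint ps → Unique ps
Disjoint⇒Unique []           []                = []
Disjoint⇒Unique (p≠∅ ∷ ps≠∅) (p⊥ps ∷ pairwise) =
  All.map (λ { p⊥p refl → Disjoint⇒¬Nonempty p⊥p (⊆-Nonempty-∩ p≠∅ ⊆-refl ⊆-refl) }) p⊥ps
  ∷ Disjoint⇒Unique ps≠∅ pairwise

blocks-unique : ∀ {c ℓ} (A : Member n (suc c) ℓ) → Unique (blocks A)
blocks-unique A = Disjoint⇒Unique (All.map ∣p∣≡1+m⇒Nonempty (size A)) (disjoint A)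

record Extension {c τ} (S : Member n c τ) (k : ℕ) (D : List (Subset n)) : Set where
  field
    extra             : List (Subset n)
    extra∉D           : All (_∉ₗ D) extra
    extended-length   : length (blocks S ++ extra) ≡ k
    extended-size     : All (λ b → ∣ b ∣ ≡ c) (blocks S ++ extra)
    extended-disjoint : AllPairs Disjoint (blocks S ++ extra)

  extended : Member n c k
  extended = member (blocks S ++ extra) extended-length extended-size extended-disjoint

open Extension

extend : ∀ {c τ k} {D : List (Subset n)} (S : Member n (suc (suc c)) τ) →
  n ≡ k * suc (suc c) → τ + 2 ≤ k → AllPairs Disjoint D → Extension S k D
extend {n} {c} {τ} {k} S n≡k*c τ+2≤k pairwise-D = record
  { extra             = pieces P
  ; extra∉D           = pieces∉D P
  ; extended-length   = trans (length-++ (blocks S)) (trans (cong₂ _+_ (len S) (pieces-length P)) τ+[2+o]≡k)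
  ; extended-size     = ++⁺ (size S) (pieces-size P)
  ; extended-disjoint = AllPairs.++⁺ (disjoint S) (pieces-disjoint P) (All.tabulate S⊥pieces)
  }
  where
  C = suc (suc c)
  U = ⋃ (blocks S)
  o = proj₁ (m≤n⇒∃[o]m+o≡n τ+2≤k)
  τ+[2+o]≡k : τ + suc (suc o) ≡ k
  τ+[2+o]≡k = trans (sym (+-assoc τ 2 o)) (proj₂ (m≤n⇒∃[o]m+o≡n τ+2≤k))
  ∣∁U∣≡ : ∣ ∁ U ∣ ≡ suc (suc o) * C
  ∣∁U∣≡ = begin
    ∣ ∁ U ∣                                  ≡⟨ ∣∁p∣≡n∸∣p∣ U ⟩
    n ∸ ∣ U ∣                                ≡⟨ cong₂ _∸_ n≡k*c (trans (∣⋃∣≡ (size S) (disjoint S)) (cong (_* C) (len S))) ⟩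
    k * C ∸ τ * C                            ≡⟨ cong (λ k → k * C ∸ τ * C) (sym τ+[2+o]≡k) ⟩
    (τ + suc (suc o)) * C ∸ τ * C            ≡⟨ cong (_∸ τ * C) (*-distribʳ-+ C τ (suc (suc o))) ⟩
    τ * C + suc (suc o) * C ∸ τ * C          ≡⟨ m+n∸m≡n (τ * C) (suc (suc o) * C) ⟩
    suc (suc o) * C                          ∎
    where open ≡-Reasoning
  P = avoidingPacking pairwise-D o ∣∁U∣≡
  S⊥pieces : ∀ {a} → a ∈ₗ blocks S → All (Disjoint a) (pieces P)
  S⊥pieces a∈S = All.map a⊥ (pieces⊆ P)
    where
    a⊥ : ∀ {b} → b ⊆ ∁ U → Disjoint _ b
    a⊥ b⊆∁U = ⊆-Disjoint (⊆⋃ a∈S) b⊆∁U (∩-inverseʳ U)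

module _ {c k t : ℕ} {F G : Family (c * k) c k} (maximal : MaximalCrossInt c k t F G) where

  maximal-closedˡ : ∀ A → (∀ B → G B → common A B ≥ t) → F A
  maximal-closedˡ A A-meets-G =
    proj₁ (proj₂ maximal F′ G (λ _ → inj₁) (λ _ → id) cross′) A (inj₂ A-meets-G)
    where
    F′ : Family (c * k) c k
    F′ A′ = F A′ ⊎ (∀ B → G B → common A′ B ≥ t)
    cross′ : CrossInt t F′ G
    cross′ A′ B (inj₁ A′∈F) B∈G = proj₁ maximal A′ B A′∈F B∈G
    cross′ A′ B (inj₂ A′-meets-G) B∈G = A′-meets-G B B∈G

  maximal-closedʳ : ∀ B → (∀ A → F A → common A B ≥ t) → G B
  maximal-closedʳ B B-meets-F =
    proj₂ (proj₂ maximal F G′ (λ _ → id) (λ _ → inj₁) cross′) B (inj₂ B-meets-F)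
    where
    G′ : Family (c * k) c k
    G′ B′ = G B′ ⊎ (∀ A → F A → common A B′ ≥ t)
    cross′ : CrossInt t F G′
    cross′ A B′ A∈F (inj₁ B′∈G) = proj₁ maximal A B′ A∈F B′∈G
    cross′ A B′ A∈F (inj₂ B′-meets-F) = B′-meets-F A A∈F

lemma2p3 : (c k t : ℕ) → c ≥ 2 → t ≥ 1 → k ≥ t + 2 →
    (F G : Family (c * k) c k) → MaximalCrossInt c k t F G →
    (τF τG : ℕ) → IsTau c t F τF → IsTau c t G τG →
    τF ≤ k ∸ 2 → τG ≤ k ∸ 2 →
    (S : Member (c * k) c τF) (S′ : Member (c * k) c τG) →
    IsCover t F S → IsCover t G S′ → common S S′ ≥ t
lemma2p3 (suc zero) _ _ (s≤s ()) _ _ _ _ _ _ _ _ _ _ _ _ _ _ _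
lemma2p3 c@(suc (suc _)) k t _ _ k≥t+2 F G maximal τF τG _ _ τF≤k-2 τG≤k-2 S S′ S-covers-F S′-covers-G =
  begin
    t            ≤⟨ proj₁ maximal A B A∈F B∈G ⟩
    common A B   ≤⟨ count-++-fresh-≤ (blocks-unique S′) (extra∉D A⁺) (extra∉D B⁺) ⟩
    common S S′  ∎
  where
  open Count (≡-dec {n = c * k} _≟B_)
  open ≤-Reasoning
  2≤k = ≤-trans (m≤n+m 2 t) k≥t+2
  A⁺ = extend S′ (*-comm c k) (m≤o∸n⇒m+n≤o τG 2≤k τG≤k-2) (disjoint S)
  A = extended A⁺
  B⁺ = extend S (*-comm c k) (m≤o∸n⇒m+n≤o τF 2≤k τF≤k-2) (disjoint A)
  B = extended B⁺
  A∈F : F A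
  A∈F = maximal-closedˡ maximal A λ B′ B′∈G →
    ≤-trans (S′-covers-G B′ B′∈G) (count≤count-++ˡ (blocks S′) (extra A⁺))
  B∈G : G B
  B∈G = maximal-closedʳ maximal B λ A′ A′∈F →
    ≤-trans (S-covers-F A′ A′∈F) (≤-trans (count-comm-≤ (blocks-unique S)) (count≤count-++ʳ (blocks A′) (blocks S) (extra B⁺)))
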